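{- Let $\ell$ be an integer with $\ell>2$. There does not exist an integer $k$ such that $f_{2\ell}(n+k)=b_{2\ell}(n)$ for all integers $n\ge -k$. However, for each positive integer $j$, writing $T_j=\sum_{i=0}^{j-1}\ell\,(2\ell)^i=[\underbrace{\ell\;\cdots\;\ell}_{j}]_{2\ell}$ and $V_m=\sum_{i=0}^{m-1}(\ell-1)(2\ell)^i=[\underbrace{(\ell-1)\;\cdots\;(\ell-1)}_{m}]_{2\ell}$, we have $$f_{2\ell}(T_j+n)=b_{2\ell}(n)\quad\text{for all integers } n\in[-V_j,\,V_{j+1}],$$ and $f_{2\ell}(T_j+n)\neq b_{2\ell}(n)$ when $n=-V_j-1$ and when $n=V_{j+1}+1$.
   Context: For an integer $d\ge 2$ and an integer $n$, a hyper-$d$-ary representation of $n$ is an expression $n=\sum_{i\ge0}\epsilon_i d^i$ with finitely many nonzero $\epsilon_i$ and all $\epsilon_i\in\{0,1,\dots,d\}$; $f_d(n)$ denotes the number of such representations (so $f_d(n)=0$ for $n<0$). For even $d=2\ell$, a balanced $2\ell$-ary representation of $n$ is such an expression with all $\epsilon_i\in\{ -\ell,-\ell+1,\dots,\ell-1,\ell\}$; $b_{2\ell}(n)$ denotes the number of such representations. Representations differing only by leading zeros are identified. Notation: $[\epsilon_k\;\cdots\;\epsilon_0]_{2\ell}=\sum_{i=0}^k\epsilon_i(2\ell)^i$. -}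

module Defs where

open import Data.Nat as ℕ using (ℕ; zero; suc)
open import Data.Integer as ℤ using (ℤ; +_; _+_; _*_; _-_; ∣_∣)
open import Data.List using (List; []; _∷_; map; concatMap; filter; length; upTo)
open import Relation.Nullary.Decidable using (Dec)

-- All digit strings of length exactly L with entries from the digit list D.
-- A string is stored least-significant digit first: ε₀ ∷ ε₁ ∷ … ∷ ε_{L-1}.
digitStrings : List ℤ → ℕ → List (List ℤ)
digitStrings D zero    = [] ∷ []
digitStrings D (suc L) = concatMap (λ e → map (e ∷_) (digitStrings D L)) D

value : ℕ → List ℤ → ℤ
value d []       = + 0
value d (e ∷ es) = e + (+ d) * value d es

countReps : ℕ → List ℤ → ℕ → ℤ → ℕ
countReps d D L n = length (filter (λ es → value d es ℤ.≟ n) (digitStrings D L))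

-- Representations differing by leading zeros are identified, so every
-- representation is counted exactly once as a string padded with zeros to a
-- fixed length L, provided L is at least the length of every normalized
-- representation.  L = |n| + 1 suffices.
reprLength : ℤ → ℕ
reprLength n = suc ∣ n ∣

hyperDigits : ℕ → List ℤ
hyperDigits d = map +_ (upTo (suc d))

balancedDigits : ℕ → List ℤ
balancedDigits ℓ = map (λ i → + i - + ℓ) (upTo (suc (2 ℕ.* ℓ)))

f : ℕ → ℤ → ℕ
f d n = countReps d (hyperDigits d) (reprLength n) n

b : ℕ → ℤ → ℕ
b ℓ n = countReps (2 ℕ.* ℓ) (balancedDigits ℓ) (reprLength n) n

repdigit : ℕ → ℕ → ℕ → ℕ
repdigit a base zero    = 0
repdigit a base (suc m) = a ℕ.+ base ℕ.* repdigit a base m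

T : ℕ → ℕ → ℤ
T ℓ j = + repdigit ℓ (2 ℕ.* ℓ) j

V : ℕ → ℕ → ℤ
V ℓ m = + repdigit (ℓ ℕ.∸ 1) (2 ℕ.* ℓ) m

-- Splitting off the units digit: over the digits {i - c : 0 ≤ i ≤ d}, a string of length L + 1
-- representing (i - c) + d·m (0 ≤ i < d) is a string of length L representing m behind the units
-- digit i - c, or, when i = 0, one representing m - 1 behind d - c.  Once L ≥ |n| these counts no
-- longer depend on L, so f = f_{2ℓ} (c = 0) and b = b_{2ℓ} (c = ℓ) satisfy, for 0 < i < 2ℓ,
--   f (2ℓ m) = f m + f (m - 1),         f (i + 2ℓ m) = f m,
--   b (-ℓ + 2ℓ m) = b m + b (m - 1),    b (i - ℓ + 2ℓ m) = b m.
-- As T_{j+1} = ℓ + 2ℓ T_j, adding T_{j+1} turns the balanced units digit i - ℓ into the hyper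
-- digit i, so the two recursions agree, and f (T_j + n) = b n follows by induction on j: for n in
-- the window [-V_{j+1}, V_{j+2}] the quotients m (and m - 1, when i = 0) stay in the previous
-- window [-V_j, V_{j+1}].  Just outside the window the same recursions give f = j, b = j + 1 on the
-- left and f = j + 1, b = j + 2 on the right.  Finally a shift k valid for all n ≥ -k must be
-- ≡ -ℓ (mod 2ℓ): otherwise some n ≡ -k with b n = 1 has f (n + k) = f W + f (W - 1) ≥ 2.  But
-- if k = -ℓ + 2ℓ m then m - 1 is again such a shift, and |m - 1| < |k|.
module Submission where

open import Algebra.Bundles using (AbelianGroup)
open import Data.Bool using (true; false)
open import Data.Integer as ℤ using (ℤ; +_; -[1+_]; _+_; _-_; -_; _*_; _≤_; _<_; ∣_∣; +≤+; +<+)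
import Data.Integer.Properties as ℤP
open import Data.Integer.DivMod using (_%ℕ_; _/ℕ_; n%ℕd<d; a≡a%ℕn+[a/ℕn]*n)
open import Data.Integer.Tactic.RingSolver using (solve-∀)
open import Data.List using (List; []; _∷_; _++_; [_]; map; concatMap; filter; length; upTo)
import Data.List.Properties as Listₚ
import Data.List.Relation.Unary.All as All
open import Data.Nat as ℕ using (ℕ; zero; suc; NonZero; z≤n)
open import Data.Nat.ListAction using (sum)
open import Data.Nat.ListAction.Properties using (sum-++)
import Data.Nat.Properties as ℕP
open import Data.Product using (_×_; _,_; proj₁; proj₂; uncurry; ∃-syntax)
open import Function using (_∘_)
open import Level using (0ℓ)
open import Relation.Binary.Definitions using (tri<; tri≈; tri>)
open import Relation.Binary.PropositionalEquality hiding ([_])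
open import Relation.Nullary using (¬_; yes; no; does; contradiction)
open import Relation.Unary using (Pred; Decidable)

open import Defs

open import Algebra.Properties.Group (AbelianGroup.group ℤP.+-0-abelianGroup)
  using (∙-cancelˡ; ∙-cancelʳ)

module _ {A : Set} {P : Pred A 0ℓ} (P? : Decidable P) where

  length-filter-++ : ∀ xs ys →
    length (filter P? (xs ++ ys)) ≡ length (filter P? xs) ℕ.+ length (filter P? ys)
  length-filter-++ xs ys =
    trans (cong length (Listₚ.filter-++ P? xs ys)) (Listₚ.length-++ (filter P? xs))

  length-filter-map : ∀ {B : Set} (g : B → A) xs →
    length (filter P? (map g xs)) ≡ length (filter (P? ∘ g) xs)
  length-filter-map g []       = refl
  length-filter-map g (x ∷ xs) with does (P? (g x))
  ... | true  = cong suc (length-filter-map g xs)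
  ... | false = length-filter-map g xs

  length-filter-concatMap : ∀ {B : Set} (g : B → List A) xs →
    length (filter P? (concatMap g xs)) ≡ sum (map (length ∘ filter P? ∘ g) xs)
  length-filter-concatMap g []       = refl
  length-filter-concatMap g (x ∷ xs) =
    trans (length-filter-++ (g x) (concatMap g xs)) (cong (_ ℕ.+_) (length-filter-concatMap g xs))

module _ (h : ℕ → ℕ) where

  sum-map-upTo-suc : ∀ n → sum (map h (upTo (suc n))) ≡ sum (map h (upTo n)) ℕ.+ h n
  sum-map-upTo-suc n = begin
    sum (map h (upTo (suc n)))               ≡⟨ cong (sum ∘ map h) (Listₚ.upTo-∷ʳ n) ⟨
    sum (map h (upTo n ++ [ n ]))            ≡⟨ cong sum (Listₚ.map-++ h (upTo n) [ n ]) ⟩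
    sum (map h (upTo n) ++ [ h n ])          ≡⟨ sum-++ (map h (upTo n)) [ h n ] ⟩
    sum (map h (upTo n)) ℕ.+ (h n ℕ.+ 0)     ≡⟨ cong (sum (map h (upTo n)) ℕ.+_) (ℕP.+-identityʳ (h n)) ⟩
    sum (map h (upTo n)) ℕ.+ h n             ∎
    where open ≡-Reasoning

  sum-map-upTo-≡0 : ∀ n → (∀ i → i ℕ.< n → h i ≡ 0) → sum (map h (upTo n)) ≡ 0
  sum-map-upTo-≡0 zero    _     = refl
  sum-map-upTo-≡0 (suc n) zeros = trans (sum-map-upTo-suc n)
    (cong₂ ℕ._+_ (sum-map-upTo-≡0 n (λ i i<n → zeros i (ℕP.m<n⇒m<1+n i<n))) (zeros n ℕP.≤-refl))

  sum-map-upTo-single : ∀ n {a} → a ℕ.< n → (∀ i → i ℕ.< n → i ≢ a → h i ≡ 0) →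
    sum (map h (upTo n)) ≡ h a
  sum-map-upTo-single (suc n) {a} a<1+n zeros with a ℕ.≟ n
  ... | yes refl = trans (sum-map-upTo-suc n) (cong (ℕ._+ h a)
    (sum-map-upTo-≡0 n (λ i i<n → zeros i (ℕP.m<n⇒m<1+n i<n) (ℕP.<⇒≢ i<n))))
  ... | no a≢n   = trans (sum-map-upTo-suc n) (trans
    (cong₂ ℕ._+_ (sum-map-upTo-single n (ℕP.≤∧≢⇒< (ℕP.≤-pred a<1+n) a≢n)
                                       (λ i i<n → zeros i (ℕP.m<n⇒m<1+n i<n)))
                 (zeros n ℕP.≤-refl (a≢n ∘ sym)))
    (ℕP.+-identityʳ (h a)))

eventually-constant : ∀ {A : Set} (g : ℕ → A) {N} → (∀ L → N ℕ.≤ L → g (suc L) ≡ g L) →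
  ∀ {L} → N ℕ.≤′ L → g L ≡ g N
eventually-constant g step ℕ.≤′-refl        = refl
eventually-constant g step (ℕ.≤′-step N≤′L) =
  trans (step _ (ℕP.≤′⇒≤ N≤′L)) (eventually-constant g step N≤′L)

∣i∣≤n⇒-n≤i≤n : ∀ {i n} → ∣ i ∣ ℕ.≤ n → - + n ≤ i × i ≤ + n
∣i∣≤n⇒-n≤i≤n {+ _}      ∣i∣≤n = ℤP.neg-≤-pos , +≤+ ∣i∣≤n
∣i∣≤n⇒-n≤i≤n { -[1+ _ ]} ∣i∣≤n = ℤP.neg-mono-≤ (+≤+ ∣i∣≤n) , ℤ.-≤+

i<suc[j]⇒i≤j : ∀ {i j} → i < ℤ.suc j → i ≤ j
i<suc[j]⇒i≤j {i} {j} i<1+j = subst (i ≤_) (ℤP.pred-suc j) (ℤP.i<j⇒i≤pred[j] i<1+j)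

j≡suc[i]⇒i<j : ∀ {i j} → j ≡ ℤ.suc i → i < j
j≡suc[i]⇒i<j j≡1+i = ℤP.suc[i]≤j⇒i<j (ℤP.≤-reflexive (sym j≡1+i))

module _ (d : ℕ) where

  residue-mono : ∀ {i j v m} → i ℕ.< d → v < m → + i + + d * v < + j + + d * m
  residue-mono {i} {j} {v} {m} i<d v<m = begin-strict
    + i + + d * v  <⟨ ℤP.+-monoˡ-< (+ d * v) (+<+ i<d) ⟩
    + d + + d * v  ≡⟨ ℤP.*-suc (+ d) v ⟨
    + d * ℤ.suc v  ≤⟨ ℤP.*-monoˡ-≤-nonNeg (+ d) (ℤP.i<j⇒suc[i]≤j v<m) ⟩
    + d * m        ≤⟨ ℤP.i≤j+i (+ d * m) (+ j) ⟩
    + j + + d * m  ∎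
    where open ℤP.≤-Reasoning

  residue-unique : ∀ {i j v m} → i ℕ.< d → j ℕ.< d → + i + + d * v ≡ + j + + d * m → i ≡ j
  residue-unique {i} {j} {v} {m} i<d j<d eq with ℤP.<-cmp v m
  ... | tri< v<m _ _  = contradiction eq (ℤP.<⇒≢ (residue-mono i<d v<m))
  ... | tri> _ _ m<v  = contradiction (sym eq) (ℤP.<⇒≢ (residue-mono j<d m<v))
  ... | tri≈ _ refl _ = ℤP.+-injective (∙-cancelʳ (+ d * v) (+ i) (+ j) eq)

module _ (d : ℕ) (D : List ℤ) where

  countRepsWithUnit : ℕ → ℤ → ℤ → ℕ
  countRepsWithUnit L e n = length (filter (λ es → value d (e ∷ es) ℤ.≟ n) (digitStrings D L))

  countReps-suc : ∀ L n → countReps d D (suc L) n ≡ sum (map (λ e → countRepsWithUnit L e n) D)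
  countReps-suc L n = trans (length-filter-concatMap represents _ D)
    (cong sum (Listₚ.map-cong (λ e → length-filter-map represents (e ∷_) (digitStrings D L)) D))
    where represents = λ es → value d es ℤ.≟ n

  countRepsWithUnit-≡ : ∀ L e m {n} .{{_ : NonZero d}} → n ≡ e + + d * m →
    countRepsWithUnit L e n ≡ countReps d D L m
  countRepsWithUnit-≡ L e m refl = cong length
    (Listₚ.filter-≐ _ _ ((λ {es} → cancel (value d es)) , λ {es} → cong (λ v → e + + d * v))
                        (digitStrings D L))
    where
    cancel : ∀ v → e + + d * v ≡ e + + d * m → v ≡ m
    cancel v eq = ℤP.*-cancelˡ-≡ (+ d) v m (∙-cancelˡ e (+ d * v) (+ d * m) eq)

  countRepsWithUnit-≢ : ∀ L e {n} → (∀ v → e + + d * v ≢ n) → countRepsWithUnit L e n ≡ 0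
  countRepsWithUnit-≢ L e miss =
    cong length (Listₚ.filter-none _ (All.universal (miss ∘ value d) (digitStrings D L)))

module IntervalDigits (d c : ℕ) .{{_ : NonZero d}} where

  digit : ℕ → ℤ
  digit i = + i - + c

  digits : List ℤ
  digits = map digit (upTo (suc d))

  count : ℕ → ℤ → ℕ
  count = countReps d digits

  -- The integers digit i + d * m with i < d fill the interval [block m, block (suc m)).
  block : ℤ → ℤ
  block m = digit 0 + + d * m

  data Split : ℤ → Set where
    split : ∀ i m → i ℕ.< d → Split (digit i + + d * m)

  splitting : ∀ n → Split n
  splitting n = subst Split (sym n≡) (split r q (n%ℕd<d (n + + c) d))
    where
    r = (n + + c) %ℕ d
    q = (n + + c) /ℕ d
    shift : ∀ n c → n ≡ (n + c) - c
    shift = solve-∀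
    regroup : ∀ r q d c → (r + q * d) - c ≡ (r - c) + d * q
    regroup = solve-∀
    n≡ : n ≡ digit r + + d * q
    n≡ = trans (shift n (+ c))
      (trans (cong (_- + c) (a≡a%ℕn+[a/ℕn]*n (n + + c) d)) (regroup (+ r) q (+ d) (+ c)))

  digit-unique : ∀ {i j v m} → i ℕ.< d → j ℕ.< d → digit i + + d * v ≡ digit j + + d * m → i ≡ j
  digit-unique {i} {j} {v} {m} i<d j<d eq = residue-unique d i<d j<d
    (trans (unshift (+ i) (+ c) (+ d) v) (trans (cong (_+ + c) eq) (sym (unshift (+ j) (+ c) (+ d) m))))
    where
    unshift : ∀ i c d v → i + d * v ≡ ((i - c) + d * v) + c
    unshift = solve-∀

  -- Only the units digits of index i and d can occur: the others have the wrong residue mod d.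
  count-suc : ∀ L {i} m → i ℕ.< d →
    count (suc L) (digit i + + d * m) ≡
    count L m ℕ.+ countRepsWithUnit d digits L (digit d) (digit i + + d * m)
  count-suc L {i} m i<d = begin
    count (suc L) n                                 ≡⟨ countReps-suc d digits L n ⟩
    sum (map withUnit (map digit (upTo (suc d))))   ≡⟨ cong sum (Listₚ.map-∘ (upTo (suc d))) ⟨
    sum (map (withUnit ∘ digit) (upTo (suc d)))     ≡⟨ sum-map-upTo-suc (withUnit ∘ digit) d ⟩
    sum (map (withUnit ∘ digit) (upTo d)) ℕ.+ withUnit (digit d)
      ≡⟨ cong (ℕ._+ withUnit (digit d)) (sum-map-upTo-single (withUnit ∘ digit) d i<d others) ⟩
    withUnit (digit i) ℕ.+ withUnit (digit d)
      ≡⟨ cong (ℕ._+ withUnit (digit d)) (countRepsWithUnit-≡ d digits L (digit i) m refl) ⟩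
    count L m ℕ.+ withUnit (digit d)                ∎
    where
    open ≡-Reasoning
    n = digit i + + d * m
    withUnit = λ e → countRepsWithUnit d digits L e n
    others : ∀ j → j ℕ.< d → j ≢ i → withUnit (digit j) ≡ 0
    others j j<d j≢i =
      countRepsWithUnit-≢ d digits L (digit j) (λ v eq → j≢i (digit-unique j<d i<d eq))

  count-suc-block : ∀ L m → count (suc L) (block m) ≡ count L m ℕ.+ count L (ℤ.pred m)
  count-suc-block L m = trans (count-suc L m (ℕ.>-nonZero⁻¹ d))
    (cong (count L m ℕ.+_) (countRepsWithUnit-≡ d digits L (digit d) (ℤ.pred m) (carry (+ c) (+ d) m)))
    where
    carry : ∀ c d m → (+ 0 - c) + d * m ≡ (d - c) + d * (-[1+ 0 ] + m)
    carry = solve-∀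

  count-suc-digit : ∀ L {i} m → 0 ℕ.< i → i ℕ.< d → count (suc L) (digit i + + d * m) ≡ count L m
  count-suc-digit L {i} m 0<i i<d = trans (count-suc L m i<d) (trans
    (cong (count L m ℕ.+_) (countRepsWithUnit-≢ d digits L (digit d) λ v eq →
      ℕP.<⇒≢ 0<i (digit-unique (ℕ.>-nonZero⁻¹ d) i<d (trans (carry (+ c) (+ d) v) eq))))
    (ℕP.+-identityʳ (count L m)))
    where
    carry : ∀ c d v → (+ 0 - c) + d * (+ 1 + v) ≡ (d - c) + d * v
    carry = solve-∀

  count-zero-≢ : ∀ {n} → n ≢ + 0 → count 0 n ≡ 0
  count-zero-≢ {n} n≢0 with + 0 ℤ.≟ n
  ... | yes 0≡n = contradiction (sym 0≡n) n≢0
  ... | no _    = refl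

  block-≤ : ∀ i m → block m ≤ digit i + + d * m
  block-≤ i m = ℤP.+-monoˡ-≤ (+ d * m) (ℤP.+-monoˡ-≤ (- + c) (+≤+ z≤n))

  <-block-suc : ∀ {i} m → i ℕ.< d → digit i + + d * m < block (ℤ.suc m)
  <-block-suc {i} m i<d = begin-strict
    digit i + + d * m       <⟨ ℤP.+-monoˡ-< (+ d * m) (ℤP.+-monoˡ-< (- + c) (+<+ i<d)) ⟩
    (+ d - + c) + + d * m   ≡⟨ carry (+ c) (+ d) m ⟩
    block (ℤ.suc m)         ∎
    where
    open ℤP.≤-Reasoning
    carry : ∀ c d m → (d - c) + d * m ≡ (+ 0 - c) + d * (+ 1 + m)
    carry = solve-∀

  block-cancel-< : ∀ {X m} → block X < block m → X < m
  block-cancel-< {X} {m} lt = ℤP.*-cancelˡ-<-nonNeg (+ d) (begin-strict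
    + d * X          ≡⟨ unshift (+ c) (+ d) X ⟩
    + c + block X    <⟨ ℤP.+-monoʳ-< (+ c) lt ⟩
    + c + block m    ≡⟨ unshift (+ c) (+ d) m ⟨
    + d * m          ∎)
    where
    open ℤP.≤-Reasoning
    unshift : ∀ c d m → d * m ≡ c + ((+ 0 - c) + d * m)
    unshift = solve-∀

  quotient-< : ∀ {i m X} → digit i + + d * m < block X → m < X
  quotient-< {i} {m} lt = block-cancel-< (ℤP.≤-<-trans (block-≤ i m) lt)

  quotient-≤ : ∀ {i m X} → digit i + + d * m < block (ℤ.suc X) → m ≤ X
  quotient-≤ lt = i<suc[j]⇒i≤j (quotient-< lt)

  quotient-≥ : ∀ {i m X} → i ℕ.< d → block X ≤ digit i + + d * m → X ≤ m
  quotient-≥ {m = m} i<d le = i<suc[j]⇒i≤j (block-cancel-< (ℤP.≤-<-trans le (<-block-suc m i<d)))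

  module Limit (stable : ∀ L n → - + L ≤ n → n ≤ + L → count (suc L) n ≡ count L n) where

    count∞ : ℤ → ℕ
    count∞ n = count (suc ∣ n ∣) n

    count≡count∞ : ∀ L n → ∣ n ∣ ℕ.≤ L → count L n ≡ count∞ n
    count≡count∞ L n ∣n∣≤L = trans
      (eventually-constant (λ L → count L n) (λ L → uncurry (stable L n) ∘ ∣i∣≤n⇒-n≤i≤n)
                           (ℕP.≤⇒≤′ ∣n∣≤L))
      (sym (uncurry (stable ∣ n ∣ n) (∣i∣≤n⇒-n≤i≤n ℕP.≤-refl)))

    count∞-zero : count∞ (+ 0) ≡ 1
    count∞-zero = stable 0 (+ 0) (+≤+ z≤n) (+≤+ z≤n)

    count∞-block : ∀ m → count∞ (block m) ≡ count∞ m ℕ.+ count∞ (ℤ.pred m)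
    count∞-block m = begin
      count∞ (block m)
        ≡⟨ count≡count∞ (suc L) (block m) (ℕP.m≤n⇒m≤1+n (ℕP.m≤m+n _ _)) ⟨
      count (suc L) (block m)           ≡⟨ count-suc-block L m ⟩
      count L m ℕ.+ count L (ℤ.pred m)  ≡⟨ cong₂ ℕ._+_ (count≡count∞ L m ∣m∣≤L)
                                                       (count≡count∞ L (ℤ.pred m) ∣pred-m∣≤L) ⟩
      count∞ m ℕ.+ count∞ (ℤ.pred m)    ∎
      where
      open ≡-Reasoning
      L = ∣ block m ∣ ℕ.+ suc ∣ m ∣
      ∣m∣≤L : ∣ m ∣ ℕ.≤ L
      ∣m∣≤L = ℕP.≤-trans (ℕP.n≤1+n ∣ m ∣) (ℕP.m≤n+m _ _)
      ∣pred-m∣≤L : ∣ ℤ.pred m ∣ ℕ.≤ L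
      ∣pred-m∣≤L = ℕP.≤-trans (ℤP.∣i+j∣≤∣i∣+∣j∣ -[1+ 0 ] m) (ℕP.m≤n+m _ _)

    count∞-digit : ∀ {i} m → 0 ℕ.< i → i ℕ.< d → count∞ (digit i + + d * m) ≡ count∞ m
    count∞-digit {i} m 0<i i<d = begin
      count∞ n          ≡⟨ count≡count∞ (suc L) n (ℕP.m≤n⇒m≤1+n (ℕP.m≤m+n _ _)) ⟨
      count (suc L) n   ≡⟨ count-suc-digit L m 0<i i<d ⟩
      count L m         ≡⟨ count≡count∞ L m (ℕP.m≤n+m _ _) ⟩
      count∞ m          ∎
      where
      open ≡-Reasoning
      n = digit i + + d * m
      L = ∣ n ∣ ℕ.+ ∣ m ∣

module HyperDigits (d : ℕ) (1<d : 1 ℕ.< d) where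

  private instance
    d-nonZero : NonZero d
    d-nonZero = ℕ.>-nonZero (ℕP.<-trans ℕ.z<s 1<d)

  open IntervalDigits d 0 {{d-nonZero}} public

  block-zero : block (+ 0) ≡ + 0
  block-zero = trans (ℤP.+-identityˡ (+ d * + 0)) (ℤP.*-zeroʳ (+ d))

  suc<block-suc : ∀ L → + suc L < block (+ suc L)
  suc<block-suc L = begin-strict
    + suc L           <⟨ +<+ (subst (suc L ℕ.<_) (ℕP.*-comm (suc L) d) (ℕP.m<m*n (suc L) d 1<d)) ⟩
    + (d ℕ.* suc L)   ≡⟨ ℤP.pos-* d (suc L) ⟩
    + d * + suc L     ≡⟨ ℤP.+-identityˡ (+ d * + suc L) ⟨
    block (+ suc L)   ∎
    where open ℤP.≤-Reasoning

  count-neg : ∀ L {n} → n < + 0 → count L n ≡ 0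
  count-neg zero    n<0 = count-zero-≢ (ℤP.<⇒≢ n<0)
  count-neg (suc L) {n} n<0 with splitting n
  ... | split zero m _      = trans (count-suc-block L m)
    (cong₂ ℕ._+_ (count-neg L m<0) (count-neg L (ℤP.≤-<-trans (ℤP.i≤j⇒pred[i]≤j ℤP.≤-refl) m<0)))
    where m<0 = quotient-< (subst (block m <_) (sym block-zero) n<0)
  ... | split (suc i) m i<d = trans (count-suc-digit L m ℕ.z<s i<d) (count-neg L m<0)
    where m<0 = quotient-< (subst (digit (suc i) + + d * m <_) (sym block-zero) n<0)

  count-stable : ∀ L n → n ≤ + L → count (suc L) n ≡ count L n
  count-stable zero    (+ zero)  _       = trans (cong (count 1) (sym block-zero)) (count-suc-block 0 (+ 0))
  count-stable zero    (+ suc _) (+≤+ ())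
  count-stable zero    -[1+ k ]  _       = trans (count-neg 1 ℤ.-<+) (sym (count-neg 0 { -[1+ k ]} ℤ.-<+))
  count-stable (suc L) n         n≤1+L with splitting n
  ... | split zero m _      = begin
    count (2 ℕ.+ L) (block m)                      ≡⟨ count-suc-block (suc L) m ⟩
    count (suc L) m ℕ.+ count (suc L) (ℤ.pred m)   ≡⟨ cong₂ ℕ._+_ (count-stable L m m≤L)
                                                        (count-stable L (ℤ.pred m) (ℤP.i≤j⇒pred[i]≤j m≤L)) ⟩
    count L m ℕ.+ count L (ℤ.pred m)               ≡⟨ count-suc-block L m ⟨
    count (suc L) (block m)                        ∎
    where
    open ≡-Reasoning
    m≤L = quotient-≤ (ℤP.≤-<-trans n≤1+L (suc<block-suc L))
  ... | split (suc i) m i<d = begin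
    count (2 ℕ.+ L) n   ≡⟨ count-suc-digit (suc L) m ℕ.z<s i<d ⟩
    count (suc L) m     ≡⟨ count-stable L m (quotient-≤ (ℤP.≤-<-trans n≤1+L (suc<block-suc L))) ⟩
    count L m           ≡⟨ count-suc-digit L m ℕ.z<s i<d ⟨
    count (suc L) n     ∎
    where open ≡-Reasoning

  count-pos : ∀ L {n} → + 0 ≤ n → n ≤ + L → 1 ℕ.≤ count L n
  count-pos zero    {+ zero}  _   _        = ℕP.≤-refl
  count-pos zero    {+ suc _} _   (+≤+ ())
  count-pos (suc L) {n}       0≤n n≤1+L with splitting n
  ... | split zero m _      = subst (1 ℕ.≤_) (sym (count-suc-block L m))
    (ℕP.≤-trans (count-pos L 0≤m m≤L) (ℕP.m≤m+n _ _))
    where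
    m≤L = quotient-≤ (ℤP.≤-<-trans n≤1+L (suc<block-suc L))
    0≤m = quotient-≥ (ℕ.>-nonZero⁻¹ d) (subst (_≤ n) (sym block-zero) 0≤n)
  ... | split (suc i) m i<d = subst (1 ℕ.≤_) (sym (count-suc-digit L m ℕ.z<s i<d)) (count-pos L 0≤m m≤L)
    where
    m≤L = quotient-≤ (ℤP.≤-<-trans n≤1+L (suc<block-suc L))
    0≤m = quotient-≥ i<d (subst (_≤ n) (sym block-zero) 0≤n)

  open Limit (λ L n _ → count-stable L n) public

  f≡count∞ : ∀ n → f d n ≡ count∞ n
  f≡count∞ n = cong (λ D → countReps d D (suc ∣ n ∣) n)
    (Listₚ.map-cong (λ i → sym (ℤP.+-identityʳ (+ i))) (upTo (suc d)))

  f-zero : f d (+ 0) ≡ 1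
  f-zero = trans (f≡count∞ (+ 0)) count∞-zero

  f-block : ∀ m → f d (block m) ≡ f d m ℕ.+ f d (ℤ.pred m)
  f-block m = begin
    f d (block m)                    ≡⟨ f≡count∞ (block m) ⟩
    count∞ (block m)                 ≡⟨ count∞-block m ⟩
    count∞ m ℕ.+ count∞ (ℤ.pred m)   ≡⟨ cong₂ ℕ._+_ (f≡count∞ m) (f≡count∞ (ℤ.pred m)) ⟨
    f d m ℕ.+ f d (ℤ.pred m)         ∎
    where open ≡-Reasoning

  f-digit : ∀ {i} m → 0 ℕ.< i → i ℕ.< d → f d (digit i + + d * m) ≡ f d m
  f-digit {i} m 0<i i<d =
    trans (f≡count∞ (digit i + + d * m)) (trans (count∞-digit m 0<i i<d) (sym (f≡count∞ m)))

  f-small : ∀ {p} → p ℕ.< d → f d (+ p) ≡ 1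
  f-small {zero}  _   = f-zero
  f-small {suc p} p<d = trans (cong (f d) (unit (+ suc p) (+ d))) (trans (f-digit (+ 0) ℕ.z<s p<d) f-zero)
    where
    unit : ∀ p d → p ≡ (p - + 0) + d * + 0
    unit = solve-∀

  f-neg : ∀ {n} → n < + 0 → f d n ≡ 0
  f-neg {n} n<0 = trans (f≡count∞ n) (count-neg (suc ∣ n ∣) n<0)

  f-pos : ∀ {n} → + 0 ≤ n → 1 ℕ.≤ f d n
  f-pos {n} 0≤n = subst (1 ℕ.≤_) (sym (f≡count∞ n))
    (count-pos (suc ∣ n ∣) 0≤n (proj₂ (∣i∣≤n⇒-n≤i≤n (ℕP.n≤1+n ∣ n ∣))))

module BalancedDigits (ℓ : ℕ) (1<ℓ : 1 ℕ.< ℓ) where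

  0<ℓ : 0 ℕ.< ℓ
  0<ℓ = ℕP.<-trans ℕ.z<s 1<ℓ

  instance
    ℓ-nonZero : NonZero ℓ
    ℓ-nonZero = ℕ.>-nonZero 0<ℓ
    2ℓ-nonZero : NonZero (2 ℕ.* ℓ)
    2ℓ-nonZero = ℕP.m*n≢0 2 ℓ

  ℓ<2ℓ : ℓ ℕ.< 2 ℕ.* ℓ
  ℓ<2ℓ = subst (ℓ ℕ.<_) (ℕP.*-comm ℓ 2) (ℕP.m<m*n ℓ 2 (ℕP.n<1+n 1))

  open IntervalDigits (2 ℕ.* ℓ) ℓ {{2ℓ-nonZero}} public

  -- + (2 ℕ.* ℓ) reduces to + ℓ + (+ ℓ + + 0), so the ring identities below write 2ℓ as
  -- D = l + (l + + 0); they then apply to l = + ℓ without rewriting.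
  block-neg : ∀ X → block (- X) ≡ - block (ℤ.suc X)
  block-neg X = reflect (+ ℓ) X
    where
    reflect : ∀ l X → let D = l + (l + + 0) in (+ 0 - l) + D * (- X) ≡ - ((+ 0 - l) + D * (+ 1 + X))
    reflect = solve-∀

  suc<block-suc : ∀ L → + suc L < block (+ suc L)
  suc<block-suc L = begin-strict
    + suc L                     <⟨ +<+ (ℕP.+-mono-<-≤ 1<ℓ (ℕP.m≤n*m L (2 ℕ.* ℓ))) ⟩
    + (ℓ ℕ.+ 2 ℕ.* ℓ ℕ.* L)     ≡⟨ cong (_+_ (+ ℓ)) (ℤP.pos-* (2 ℕ.* ℓ) L) ⟩
    + ℓ + + (2 ℕ.* ℓ) * + L     ≡⟨ carry (+ ℓ) (+ L) ⟨
    block (+ suc L)             ∎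
    where
    open ℤP.≤-Reasoning
    carry : ∀ l L → let D = l + (l + + 0) in (+ 0 - l) + D * (+ 1 + L) ≡ l + D * L
    carry = solve-∀

  block-neg<-suc : ∀ L → block (- + L) < - + suc L
  block-neg<-suc L = subst (_< - + suc L) (sym (block-neg (+ L))) (ℤP.neg-mono-< (suc<block-suc L))

  count-stable : ∀ L n → - + L ≤ n → n ≤ + L → count (suc L) n ≡ count L n
  count-stable zero    (+ zero)  _ _        =
    trans (cong (count 1) (centre (+ ℓ) (+ (2 ℕ.* ℓ)))) (count-suc-digit 0 (+ 0) 0<ℓ ℓ<2ℓ)
    where
    centre : ∀ l D → + 0 ≡ (l - l) + D * + 0
    centre = solve-∀
  count-stable zero    (+ suc _) _ (+≤+ ())
  count-stable zero    -[1+ _ ]  () _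
  count-stable (suc L) n         -1-L≤n n≤1+L with splitting n
  ... | split zero m _      = begin
    count (2 ℕ.+ L) (block m)                      ≡⟨ count-suc-block (suc L) m ⟩
    count (suc L) m ℕ.+ count (suc L) (ℤ.pred m)   ≡⟨ cong₂ ℕ._+_
                                                        (count-stable L m (ℤP.<⇒≤ -L<m) m≤L)
                                                        (count-stable L (ℤ.pred m) (ℤP.i<j⇒i≤pred[j] -L<m)
                                                                                   (ℤP.i≤j⇒pred[i]≤j m≤L)) ⟩
    count L m ℕ.+ count L (ℤ.pred m)               ≡⟨ count-suc-block L m ⟨
    count (suc L) (block m)                        ∎
    where
    open ≡-Reasoning
    m≤L = quotient-≤ (ℤP.≤-<-trans n≤1+L (suc<block-suc L))
    -L<m = block-cancel-< (ℤP.<-≤-trans (block-neg<-suc L) -1-L≤n)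
  ... | split (suc i) m i<d = begin
    count (2 ℕ.+ L) n   ≡⟨ count-suc-digit (suc L) m ℕ.z<s i<d ⟩
    count (suc L) m     ≡⟨ count-stable L m -L≤m m≤L ⟩
    count L m           ≡⟨ count-suc-digit L m ℕ.z<s i<d ⟨
    count (suc L) n     ∎
    where
    open ≡-Reasoning
    m≤L = quotient-≤ (ℤP.≤-<-trans n≤1+L (suc<block-suc L))
    -L≤m = quotient-≥ i<d (ℤP.<⇒≤ (ℤP.<-≤-trans (block-neg<-suc L) -1-L≤n))

  open Limit count-stable

  b-zero : b ℓ (+ 0) ≡ 1
  b-zero = count∞-zero

  b-block : ∀ m → b ℓ (block m) ≡ b ℓ m ℕ.+ b ℓ (ℤ.pred m)
  b-block = count∞-block

  b-digit : ∀ {i} m → 0 ℕ.< i → i ℕ.< 2 ℕ.* ℓ → b ℓ (digit i + + (2 ℕ.* ℓ) * m) ≡ b ℓ m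
  b-digit = count∞-digit

  b-small : ∀ {p} → p ℕ.< ℓ → b ℓ (+ p) ≡ 1
  b-small {p} p<ℓ = trans (cong (b ℓ) (recentre (+ p) (+ ℓ) (+ (2 ℕ.* ℓ))))
    (trans (b-digit (+ 0) 0<p+ℓ p+ℓ<2ℓ) b-zero)
    where
    recentre : ∀ p l D → p ≡ ((p + l) - l) + D * + 0
    recentre = solve-∀
    0<p+ℓ : 0 ℕ.< p ℕ.+ ℓ
    0<p+ℓ = ℕP.<-≤-trans 0<ℓ (ℕP.m≤n+m ℓ p)
    p+ℓ<2ℓ : p ℕ.+ ℓ ℕ.< 2 ℕ.* ℓ
    p+ℓ<2ℓ = subst (p ℕ.+ ℓ ℕ.<_) (cong (ℓ ℕ.+_) (sym (ℕP.+-identityʳ ℓ))) (ℕP.+-monoˡ-< ℓ p<ℓ)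

module HyperVersusBalanced (ℓ : ℕ) (1<ℓ : 1 ℕ.< ℓ) where

  module B = BalancedDigits ℓ 1<ℓ
  open B using (0<ℓ; ℓ<2ℓ; 2ℓ-nonZero)

  d : ℕ
  d = 2 ℕ.* ℓ

  module H = HyperDigits d (ℕP.<-trans 1<ℓ ℓ<2ℓ)

  ℓ-1≡ : + (ℓ ℕ.∸ 1) ≡ + ℓ - + 1
  ℓ-1≡ = trans (sym (ℤP.⊖-≥ (ℕP.<⇒≤ 1<ℓ))) (sym (ℤP.m-n≡m⊖n ℓ 1))

  T-suc : ∀ j → T ℓ (suc j) ≡ + ℓ + + d * T ℓ j
  T-suc j = cong (_+_ (+ ℓ)) (ℤP.pos-* d (repdigit ℓ d j))

  V-suc : ∀ j → V ℓ (suc j) ≡ (+ ℓ - + 1) + + d * V ℓ j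
  V-suc j = cong₂ _+_ ℓ-1≡ (ℤP.pos-* d (repdigit (ℓ ℕ.∸ 1) d j))

  V-≥ : ∀ j → + j ≤ V ℓ j
  V-≥ j = +≤+ (grows j)
    where
    grows : ∀ j → j ℕ.≤ repdigit (ℓ ℕ.∸ 1) d j
    grows zero    = z≤n
    grows (suc j) = ℕP.+-mono-≤ (ℕP.m<n⇒0<n∸m 1<ℓ) (ℕP.≤-trans (grows j) (ℕP.m≤n*m _ d))

  quotient-≤-V : ∀ j {i m} → B.digit i + + d * m ≤ V ℓ (suc (suc j)) → m ≤ V ℓ (suc j)
  quotient-≤-V j n≤V = B.quotient-≤ (ℤP.≤-<-trans n≤V (j≡suc[i]⇒i<j
    (trans (carry (+ ℓ) (V ℓ (suc j))) (cong ℤ.suc (sym (V-suc (suc j)))))))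
    where
    carry : ∀ l W → let D = l + (l + + 0) in (+ 0 - l) + D * (+ 1 + W) ≡ + 1 + ((l - + 1) + D * W)
    carry = solve-∀

  block[-V]<-V-suc : ∀ j → B.block (- V ℓ j) < - V ℓ (suc j)
  block[-V]<-V-suc j = j≡suc[i]⇒i<j (trans (cong -_ (V-suc j)) (borrow (+ ℓ) (V ℓ j)))
    where
    borrow : ∀ l W → let D = l + (l + + 0) in - ((l - + 1) + D * W) ≡ + 1 + ((+ 0 - l) + D * (- W))
    borrow = solve-∀

  quotient>-V : ∀ j {m} → - V ℓ (suc j) ≤ B.block m → - V ℓ j < m
  quotient>-V j -V≤n = B.block-cancel-< (ℤP.<-≤-trans (block[-V]<-V-suc j) -V≤n)

  quotient-≥-V : ∀ j {i m} → i ℕ.< d → - V ℓ (suc j) ≤ B.digit i + + d * m → - V ℓ j ≤ m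
  quotient-≥-V j i<d -V≤n = B.quotient-≥ i<d (ℤP.<⇒≤ (ℤP.<-≤-trans (block[-V]<-V-suc j) -V≤n))

  T-suc+digit : ∀ j i m → T ℓ (suc j) + (B.digit i + + d * m) ≡ H.digit i + + d * (T ℓ j + m)
  T-suc+digit j i m =
    trans (cong (_+ (B.digit i + + d * m)) (T-suc j)) (regroup (+ ℓ) (+ i) (T ℓ j) m)
    where
    regroup : ∀ l i T m → let D = l + (l + + 0) in
      (l + D * T) + ((i - l) + D * m) ≡ (i - + 0) + D * (T + m)
    regroup = solve-∀

  f[T+n]≡b[n] : ∀ j n → - V ℓ j ≤ n → n ≤ V ℓ (suc j) → f d (T ℓ j + n) ≡ b ℓ n
  f[T+n]≡b[n] zero    (+ p) _ p≤V₁ = trans (H.f-small (ℕP.<-trans p<ℓ ℓ<2ℓ)) (sym (B.b-small p<ℓ))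
    where
    top : ∀ l D → l ≡ + 1 + ((l - + 1) + D * + 0)
    top = solve-∀
    p<ℓ : p ℕ.< ℓ
    p<ℓ = ℤP.drop‿+<+ (ℤP.≤-<-trans p≤V₁ (j≡suc[i]⇒i<j
      (trans (top (+ ℓ) (+ d)) (cong ℤ.suc (sym (V-suc 0))))))
  f[T+n]≡b[n] (suc j) n -V≤n n≤V with B.splitting n
  ... | B.split zero m _ = begin
    f d (T ℓ (suc j) + B.block m)                 ≡⟨ cong (f d) (T-suc+digit j 0 m) ⟩
    f d (H.block (T ℓ j + m))                     ≡⟨ H.f-block (T ℓ j + m) ⟩
    f d (T ℓ j + m) ℕ.+ f d (ℤ.pred (T ℓ j + m))
      ≡⟨ cong (λ x → f d (T ℓ j + m) ℕ.+ f d x) (pred-+ (T ℓ j) m) ⟩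
    f d (T ℓ j + m) ℕ.+ f d (T ℓ j + ℤ.pred m)
      ≡⟨ cong₂ ℕ._+_ (f[T+n]≡b[n] j m (ℤP.<⇒≤ -V<m) m≤V)
                     (f[T+n]≡b[n] j (ℤ.pred m) (ℤP.i<j⇒i≤pred[j] -V<m) (ℤP.i≤j⇒pred[i]≤j m≤V)) ⟩
    b ℓ m ℕ.+ b ℓ (ℤ.pred m)                      ≡⟨ B.b-block m ⟨
    b ℓ (B.block m)                               ∎
    where
    open ≡-Reasoning
    m≤V = quotient-≤-V j n≤V
    -V<m = quotient>-V j -V≤n
    pred-+ : ∀ T m → -[1+ 0 ] + (T + m) ≡ T + (-[1+ 0 ] + m)
    pred-+ = solve-∀
  ... | B.split (suc i) m i<d = begin
    f d (T ℓ (suc j) + (B.digit (suc i) + + d * m))  ≡⟨ cong (f d) (T-suc+digit j (suc i) m) ⟩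
    f d (H.digit (suc i) + + d * (T ℓ j + m))        ≡⟨ H.f-digit (T ℓ j + m) ℕ.z<s i<d ⟩
    f d (T ℓ j + m)                                  ≡⟨ f[T+n]≡b[n] j m (quotient-≥-V j i<d -V≤n) (quotient-≤-V j n≤V) ⟩
    b ℓ m                                            ≡⟨ B.b-digit m ℕ.z<s i<d ⟨
    b ℓ (B.digit (suc i) + + d * m)                  ∎
    where open ≡-Reasoning

  f[T-V]≡1 : ∀ j → f d (T ℓ j - V ℓ j) ≡ 1
  f[T-V]≡1 zero    = H.f-zero
  f[T-V]≡1 (suc j) = begin
    f d (T ℓ (suc j) - V ℓ (suc j))
      ≡⟨ cong (f d) (trans (cong₂ _-_ (T-suc j) (V-suc j)) (lead (+ ℓ) (T ℓ j) (V ℓ j))) ⟩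
    f d (H.digit 1 + + d * (T ℓ j - V ℓ j))  ≡⟨ H.f-digit (T ℓ j - V ℓ j) ℕ.z<s (ℕP.<-trans 1<ℓ ℓ<2ℓ) ⟩
    f d (T ℓ j - V ℓ j)                      ≡⟨ f[T-V]≡1 j ⟩
    1                                        ∎
    where
    open ≡-Reasoning
    lead : ∀ l T V → let D = l + (l + + 0) in
      (l + D * T) - ((l - + 1) + D * V) ≡ (+ 1 - + 0) + D * (T - V)
    lead = solve-∀

  f[T-V-1]≡j : ∀ j → f d (T ℓ j + (- V ℓ j - + 1)) ≡ j
  f[T-V-1]≡j zero    = H.f-neg { -[1+ 0 ]} ℤ.-<+
  f[T-V-1]≡j (suc j) = begin
    f d (T ℓ (suc j) + (- V ℓ (suc j) - + 1))
      ≡⟨ cong (f d) (trans (cong₂ (λ t v → t + (- v - + 1)) (T-suc j) (V-suc j))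
                           (lead (+ ℓ) (T ℓ j) (V ℓ j))) ⟩
    f d (H.block (T ℓ j - V ℓ j))                           ≡⟨ H.f-block (T ℓ j - V ℓ j) ⟩
    f d (T ℓ j - V ℓ j) ℕ.+ f d (ℤ.pred (T ℓ j - V ℓ j))
      ≡⟨ cong₂ ℕ._+_ (f[T-V]≡1 j) (cong (f d) (pred-- (T ℓ j) (V ℓ j))) ⟩
    1 ℕ.+ f d (T ℓ j + (- V ℓ j - + 1))                     ≡⟨ cong suc (f[T-V-1]≡j j) ⟩
    suc j                                                   ∎
    where
    open ≡-Reasoning
    lead : ∀ l T V → let D = l + (l + + 0) in
      (l + D * T) + (- ((l - + 1) + D * V) - + 1) ≡ (+ 0 - + 0) + D * (T - V)
    lead = solve-∀
    pred-- : ∀ T V → -[1+ 0 ] + (T - V) ≡ T + (- V - + 1)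
    pred-- = solve-∀

  b[-V]≡1 : ∀ j → b ℓ (- V ℓ j) ≡ 1
  b[-V]≡1 zero    = B.b-zero
  b[-V]≡1 (suc j) = begin
    b ℓ (- V ℓ (suc j))                ≡⟨ cong (b ℓ) (trans (cong -_ (V-suc j)) (lead (+ ℓ) (V ℓ j))) ⟩
    b ℓ (B.digit 1 + + d * (- V ℓ j))  ≡⟨ B.b-digit (- V ℓ j) ℕ.z<s (ℕP.<-trans 1<ℓ ℓ<2ℓ) ⟩
    b ℓ (- V ℓ j)                      ≡⟨ b[-V]≡1 j ⟩
    1                                  ∎
    where
    open ≡-Reasoning
    lead : ∀ l V → let D = l + (l + + 0) in - ((l - + 1) + D * V) ≡ (+ 1 - l) + D * (- V)
    lead = solve-∀

  b[-V-1]≡1+j : ∀ j → b ℓ (- V ℓ j - + 1) ≡ suc j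
  b[-V-1]≡1+j zero    = begin
    b ℓ -[1+ 0 ]
      ≡⟨ cong (b ℓ) (trans (lead (+ ℓ) (+ d)) (cong (λ a → (a - + ℓ) + + d * + 0) (sym ℓ-1≡))) ⟩
    b ℓ (B.digit (ℓ ℕ.∸ 1) + + d * + 0)
      ≡⟨ B.b-digit (+ 0) (ℕP.m<n⇒0<n∸m 1<ℓ) (ℕP.≤-<-trans (ℕP.m∸n≤m ℓ 1) ℓ<2ℓ) ⟩
    b ℓ (+ 0)                            ≡⟨ B.b-zero ⟩
    1                                    ∎
    where
    open ≡-Reasoning
    lead : ∀ l D → -[1+ 0 ] ≡ ((l - + 1) - l) + D * + 0
    lead = solve-∀
  b[-V-1]≡1+j (suc j) = begin
    b ℓ (- V ℓ (suc j) - + 1)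
      ≡⟨ cong (b ℓ) (trans (cong (λ v → - v - + 1) (V-suc j)) (lead (+ ℓ) (V ℓ j))) ⟩
    b ℓ (B.block (- V ℓ j))                    ≡⟨ B.b-block (- V ℓ j) ⟩
    b ℓ (- V ℓ j) ℕ.+ b ℓ (ℤ.pred (- V ℓ j))
      ≡⟨ cong₂ ℕ._+_ (b[-V]≡1 j) (cong (b ℓ) (ℤP.+-comm -[1+ 0 ] (- V ℓ j))) ⟩
    1 ℕ.+ b ℓ (- V ℓ j - + 1)                  ≡⟨ cong suc (b[-V-1]≡1+j j) ⟩
    suc (suc j)                                ∎
    where
    open ≡-Reasoning
    lead : ∀ l V → let D = l + (l + + 0) in - ((l - + 1) + D * V) - + 1 ≡ (+ 0 - l) + D * (- V)
    lead = solve-∀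

  b[V]≡1 : ∀ j → b ℓ (V ℓ j) ≡ 1
  b[V]≡1 zero    = B.b-zero
  b[V]≡1 (suc j) = begin
    b ℓ (V ℓ (suc j))
      ≡⟨ cong (b ℓ) (trans (V-suc j) (trans (lead (+ ℓ) (+ d) (V ℓ j))
                      (cong (λ a → ((+ ℓ + a) - + ℓ) + + d * V ℓ j) (sym ℓ-1≡)))) ⟩
    b ℓ (B.digit (ℓ ℕ.+ (ℓ ℕ.∸ 1)) + + d * V ℓ j)
      ≡⟨ B.b-digit (V ℓ j) (ℕP.<-≤-trans 0<ℓ (ℕP.m≤m+n ℓ _)) top<d ⟩
    b ℓ (V ℓ j)                                     ≡⟨ b[V]≡1 j ⟩
    1                                               ∎
    where
    open ≡-Reasoning
    lead : ∀ l D V → (l - + 1) + D * V ≡ ((l + (l - + 1)) - l) + D * V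
    lead = solve-∀
    top<d : ℓ ℕ.+ (ℓ ℕ.∸ 1) ℕ.< d
    top<d = ℕP.+-monoʳ-< ℓ (ℕP.<-≤-trans (ℕP.∸-monoʳ-< ℕ.z<s (ℕP.<⇒≤ 1<ℓ)) (ℕP.m≤m+n ℓ 0))

  b[V+1]≡j : ∀ j → b ℓ (V ℓ j + + 1) ≡ suc j
  b[V+1]≡j zero    = B.b-small 1<ℓ
  b[V+1]≡j (suc j) = begin
    b ℓ (V ℓ (suc j) + + 1)
      ≡⟨ cong (b ℓ) (trans (cong (_+ + 1) (V-suc j)) (carry (+ ℓ) (V ℓ j))) ⟩
    b ℓ (B.block (V ℓ j + + 1))                       ≡⟨ B.b-block (V ℓ j + + 1) ⟩
    b ℓ (V ℓ j + + 1) ℕ.+ b ℓ (ℤ.pred (V ℓ j + + 1))  ≡⟨ cong₂ ℕ._+_ (b[V+1]≡j j) (cong (b ℓ) (pred-+1 (V ℓ j))) ⟩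
    suc j ℕ.+ b ℓ (V ℓ j)                             ≡⟨ cong (suc j ℕ.+_) (b[V]≡1 j) ⟩
    suc j ℕ.+ 1                                       ≡⟨ ℕP.+-comm (suc j) 1 ⟩
    suc (suc j)                                       ∎
    where
    open ≡-Reasoning
    carry : ∀ l V → let D = l + (l + + 0) in ((l - + 1) + D * V) + + 1 ≡ (+ 0 - l) + D * (V + + 1)
    carry = solve-∀
    pred-+1 : ∀ V → -[1+ 0 ] + (V + + 1) ≡ V
    pred-+1 = solve-∀

  f[T+V+1]≡1+j : ∀ j → f d (T ℓ j + (V ℓ (suc j) + + 1)) ≡ suc j
  f[T+V+1]≡1+j zero    =
    trans (cong (f d) (trans (cong (λ v → + 0 + (v + + 1)) (V-suc 0)) (top (+ ℓ) (+ d)))) (H.f-small ℓ<2ℓ)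
    where
    top : ∀ l D → + 0 + (((l - + 1) + D * + 0) + + 1) ≡ l
    top = solve-∀
  f[T+V+1]≡1+j (suc j) = begin
    f d (T ℓ (suc j) + (V ℓ (suc (suc j)) + + 1))
      ≡⟨ cong (f d) (trans (cong₂ (λ t v → t + (v + + 1)) (T-suc j) (V-suc (suc j)))
                           (carry (+ ℓ) (T ℓ j) W)) ⟩
    f d (H.block (T ℓ j + (W + + 1)))                             ≡⟨ H.f-block (T ℓ j + (W + + 1)) ⟩
    f d (T ℓ j + (W + + 1)) ℕ.+ f d (ℤ.pred (T ℓ j + (W + + 1)))
      ≡⟨ cong₂ ℕ._+_ (f[T+V+1]≡1+j j) (cong (f d) (pred-+1 (T ℓ j) W)) ⟩
    suc j ℕ.+ f d (T ℓ j + W)      ≡⟨ cong (suc j ℕ.+_) (f[T+n]≡b[n] j W ℤP.neg-≤-pos ℤP.≤-refl) ⟩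
    suc j ℕ.+ b ℓ W                ≡⟨ cong (suc j ℕ.+_) (b[V]≡1 (suc j)) ⟩
    suc j ℕ.+ 1                    ≡⟨ ℕP.+-comm (suc j) 1 ⟩
    suc (suc j)                    ∎
    where
    open ≡-Reasoning
    W = V ℓ (suc j)
    carry : ∀ l T W → let D = l + (l + + 0) in
      (l + D * T) + (((l - + 1) + D * W) + + 1) ≡ (+ 0 - + 0) + D * (T + (W + + 1))
    carry = solve-∀
    pred-+1 : ∀ T W → -[1+ 0 ] + (T + (W + + 1)) ≡ T + W
    pred-+1 = solve-∀

  MatchingShift : ℤ → Set
  MatchingShift k = ∀ n → - k ≤ n → f d (n + k) ≡ b ℓ n

  shift-descent : ∀ m → MatchingShift (B.block m) → MatchingShift (ℤ.pred m)
  shift-descent m match n -m+1≤n = begin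
    f d (n + ℤ.pred m)                      ≡⟨ H.f-digit (n + ℤ.pred m) 0<ℓ ℓ<2ℓ ⟨
    f d (H.digit ℓ + + d * (n + ℤ.pred m))  ≡⟨ cong (f d) (regroup (+ ℓ) n m) ⟩
    f d (+ d * n + B.block m)               ≡⟨ match (+ d * n) -block≤dn ⟩
    b ℓ (+ d * n)                           ≡⟨ cong (b ℓ) (centre (+ ℓ) (+ d * n)) ⟩
    b ℓ (B.digit ℓ + + d * n)               ≡⟨ B.b-digit n 0<ℓ ℓ<2ℓ ⟩
    b ℓ n                                   ∎
    where
    open ≡-Reasoning
    regroup : ∀ l n m → let D = l + (l + + 0) in
      (l - + 0) + D * (n + (-[1+ 0 ] + m)) ≡ D * n + ((+ 0 - l) + D * m)
    regroup = solve-∀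
    centre : ∀ l x → x ≡ (l - l) + x
    centre = solve-∀
    flip : ∀ l m → let D = l + (l + + 0) in - ((+ 0 - l) + D * m) + l ≡ D * (- (-[1+ 0 ] + m))
    flip = solve-∀
    -block≤dn : - B.block m ≤ + d * n
    -block≤dn = ℤP.≤-trans (ℤP.i≤i+j (- B.block m) (+ ℓ))
      (ℤP.≤-trans (ℤP.≤-reflexive (flip (+ ℓ) m)) (ℤP.*-monoˡ-≤-nonNeg (+ d) -m+1≤n))

  -- The test point n ≡ -k (mod 2ℓ) has quotient W = V_{|m|+1}, so that b n = 1 and W + m ≥ 1.
  shift-residue : ∀ {i} m → 0 ℕ.< i → i ℕ.< d → ¬ MatchingShift (B.digit i + + d * m)
  shift-residue {i} m 0<i i<d match =
    ℕP.<-irrefl refl (subst (2 ℕ.≤_) (trans (match n -k≤n) b[n]≡1) 2≤f[n+k])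
    where
    k = B.digit i + + d * m
    e = d ℕ.∸ i
    W = V ℓ (suc ∣ m ∣)
    n = B.digit e + + d * W
    e≡ : + e ≡ + d - + i
    e≡ = trans (sym (ℤP.⊖-≥ (ℕP.<⇒≤ i<d))) (sym (ℤP.m-n≡m⊖n d i))
    cancel : ∀ l i W m → let D = l + (l + + 0) in
      (((D - i) - l) + D * W) + ((i - l) + D * m) ≡ (+ 0 - + 0) + D * (W + m)
    cancel = solve-∀
    n+k≡ : n + k ≡ H.block (W + m)
    n+k≡ = trans (cong (λ x → ((x - + ℓ) + + d * W) + k) e≡) (cancel (+ ℓ) (+ i) W m)
    one : ∀ a → + 1 ≡ (+ 1 + a) + - a
    one = solve-∀
    0<W+m : + 0 < W + m
    0<W+m = ℤP.suc[i]≤j⇒i<j (begin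
      + 1                      ≡⟨ one (+ ∣ m ∣) ⟩
      + suc ∣ m ∣ + - + ∣ m ∣
        ≤⟨ ℤP.+-mono-≤ (V-≥ (suc ∣ m ∣)) (proj₁ (∣i∣≤n⇒-n≤i≤n {m} ℕP.≤-refl)) ⟩
      W + m                    ∎)
      where open ℤP.≤-Reasoning
    -k≤n : - k ≤ n
    -k≤n = ℤP.0≤i-j⇒j≤i (begin
      + 0              ≡⟨ H.block-zero ⟨
      H.block (+ 0)    ≤⟨ ℤP.+-monoʳ-≤ (H.digit 0) (ℤP.*-monoˡ-≤-nonNeg (+ d) (ℤP.<⇒≤ 0<W+m)) ⟩
      H.block (W + m)  ≡⟨ n+k≡ ⟨
      n + k            ≡⟨ cong (_+_ n) (ℤP.neg-involutive k) ⟨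
      n - - k          ∎)
      where open ℤP.≤-Reasoning
    2≤f[n+k] : 2 ℕ.≤ f d (n + k)
    2≤f[n+k] = subst (2 ℕ.≤_) (sym (trans (cong (f d) n+k≡) (H.f-block (W + m))))
      (ℕP.+-mono-≤ (H.f-pos (ℤP.<⇒≤ 0<W+m)) (H.f-pos (ℤP.i<j⇒i≤pred[j] 0<W+m)))
    b[n]≡1 : b ℓ n ≡ 1
    b[n]≡1 = trans (B.b-digit W (ℕP.m<n⇒0<n∸m i<d) (ℕP.∸-monoʳ-< 0<i (ℕP.<⇒≤ i<d)))
                   (b[V]≡1 (suc ∣ m ∣))

  ∣pred∣<∣block∣ : ∀ m → ∣ ℤ.pred m ∣ ℕ.< ∣ B.block m ∣
  ∣pred∣<∣block∣ (+ zero)  = begin-strict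
    1                        <⟨ 1<ℓ ⟩
    ℓ                        ≡⟨ ℤP.∣-i∣≡∣i∣ (+ ℓ) ⟨
    ∣ - + ℓ ∣                ≡⟨ cong ∣_∣ (base (+ ℓ) (+ d)) ⟨
    ∣ B.block (+ 0) ∣        ∎
    where
    open ℕP.≤-Reasoning
    base : ∀ l D → (+ 0 - l) + D * + 0 ≡ - l
    base = solve-∀
  ∣pred∣<∣block∣ (+ suc p) = begin-strict
    p                        <⟨ ℕP.+-mono-<-≤ 0<ℓ (ℕP.m≤n*m p d) ⟩
    ℓ ℕ.+ d ℕ.* p            ≡⟨ cong (λ x → ∣ + ℓ + x ∣) (ℤP.pos-* d p) ⟩
    ∣ + ℓ + + d * + p ∣      ≡⟨ cong ∣_∣ (carry (+ ℓ) (+ p)) ⟨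
    ∣ B.block (+ suc p) ∣    ∎
    where
    open ℕP.≤-Reasoning
    carry : ∀ l p → let D = l + (l + + 0) in (+ 0 - l) + D * (+ 1 + p) ≡ l + D * p
    carry = solve-∀
  ∣pred∣<∣block∣ -[1+ p ]  = begin-strict
    suc (suc p)                     <⟨ ℕP.+-mono-<-≤ 1<ℓ (ℕP.m≤n*m (suc p) d) ⟩
    ℓ ℕ.+ d ℕ.* suc p               ≡⟨ ℤP.∣-i∣≡∣i∣ (+ (ℓ ℕ.+ d ℕ.* suc p)) ⟨
    ∣ - + (ℓ ℕ.+ d ℕ.* suc p) ∣     ≡⟨ cong (λ x → ∣ - (+ ℓ + x) ∣) (ℤP.pos-* d (suc p)) ⟩
    ∣ - (+ ℓ + + d * + suc p) ∣     ≡⟨ cong ∣_∣ (negate (+ ℓ) (+ d) (+ suc p)) ⟨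
    ∣ B.block -[1+ p ] ∣            ∎
    where
    open ℕP.≤-Reasoning
    negate : ∀ l D q → (+ 0 - l) + D * (- q) ≡ - (l + D * q)
    negate = solve-∀

  no-shift-below : ∀ N k → ∣ k ∣ ℕ.< N → ¬ MatchingShift k
  no-shift-below (suc N) k ∣k∣<1+N match with B.splitting k
  ... | B.split zero    m _   =
    no-shift-below N (ℤ.pred m) (ℕP.<-≤-trans (∣pred∣<∣block∣ m) (ℕP.≤-pred ∣k∣<1+N)) (shift-descent m match)
  ... | B.split (suc i) m i<d = shift-residue m ℕ.z<s i<d match

  no-shift : ∀ k → ¬ MatchingShift k
  no-shift k = no-shift-below (suc ∣ k ∣) k ℕP.≤-refl

theorem6p1 : (ℓ : ℕ) → 2 ℕ.< ℓ →
    (¬ (∃[ k ] ((n : ℤ) → - k ≤ n → f (2 ℕ.* ℓ) (n + k) ≡ b ℓ n)))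
    × ((j : ℕ) → 1 ℕ.≤ j →
        ((n : ℤ) → - V ℓ j ≤ n → n ≤ V ℓ (suc j) → f (2 ℕ.* ℓ) (T ℓ j + n) ≡ b ℓ n)
        × (f (2 ℕ.* ℓ) (T ℓ j + (- V ℓ j - + 1)) ≢ b ℓ (- V ℓ j - + 1))
        × (f (2 ℕ.* ℓ) (T ℓ j + (V ℓ (suc j) + + 1)) ≢ b ℓ (V ℓ (suc j) + + 1)))
theorem6p1 ℓ 2<ℓ =
  uncurry no-shift ,
  λ j _ → f[T+n]≡b[n] j
        , (λ eq → ℕP.1+n≢n (trans (sym (b[-V-1]≡1+j j)) (trans (sym eq) (f[T-V-1]≡j j))))
        , (λ eq → ℕP.1+n≢n (trans (sym (b[V+1]≡j (suc j))) (trans (sym eq) (f[T+V+1]≡1+j j))))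
  where open HyperVersusBalanced ℓ (ℕP.<-trans (ℕP.n<1+n 1) 2<ℓ)
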